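{- Let $\mathcal{G}=(\mathcal{V},\mathcal{E})$ be a temporal graph with $|\mathcal{V}|=n$ and $|\mathcal{E}|=m\ge 1$ (edges possibly associated with multiple time intervals), and let $\mathcal{N}^*=\frac{1}{m}\sum_{e\in\mathcal{E}}\mathcal{N}(e)$ be the average overlapping number of the edges of $\mathcal{E}$. Then the greedy algorithm described in the context finds a $\frac{1}{\mathcal{N}^*+1}$-approximate maximum 0-1 timed matching for $\mathcal{G}$, i.e. its output $M$ satisfies $|M|\ge\frac{1}{\mathcal{N}^*+1}|M^{opt}|$ for every maximum 0-1 timed matching $M^{opt}$ of $\mathcal{G}$.
   Context: A temporal graph $\mathcal{G}=(\mathcal{V},\mathcal{E})$ with lifetime $\mathcal{T}$ has a finite node set and a finite edge set; each edge joins two distinct nodes (no self-loops, at most one edge per pair) and is associated with a nonempty list of time intervals $[s_1,f_1),\dots,[s_k,f_k)$ with integers $0\le s_1<f_1<s_2<\dots<s_k<f_k\le\mathcal{T}$, existing at each integer timestep in one of them. Two distinct edges overlap if they share an endpoint and exist at a common timestep. The overlapping number $\mathcal{N}(e)$ of $e\in\mathcal{E}$ is the number of edges of $\mathcal{E}$ overlapping $e$. A 0-1 timed matching is a set of edges no two of which overlap; a maximum one has maximum cardinality. Greedy algorithm: let $E':=\mathcal{E}$, $M:=\emptyset$. While $E'\ne\emptyset$: choose $e\in E'$ whose number of overlapping edges within $E'$ is minimum (ties broken arbitrarily), add $e$ to $M$, and remove $e$ and all edges of $E'$ overlapping $e$ from $E'$. Output $M$. -}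

module Defs where

open import Data.Nat using (ℕ; zero; suc; _+_; _*_; _≤_; _<_; _≤?_; _<?_)
open import Data.Nat.Properties using (≤-trans; m≤m+n; m≤n+m; <-≤-trans)
open import Data.Fin using (Fin; toℕ; fromℕ<)
open import Data.Fin.Properties using (toℕ-fromℕ<) renaming (_≟_ to _≟ᶠ_; any? to anyFin?)
open import Data.Product using (Σ; ∃; ∃-syntax; _×_; _,_; proj₁; proj₂)
open import Data.Product.Properties using ()
open import Data.Sum using (_⊎_; inj₁; inj₂)
open import Data.List using (List; []; _∷_; length; filter; allFin; foldr; map)
open import Data.Nat.ListAction using (sum)
open import Data.List.Relation.Unary.Any using (Any; here; there; any?)
open import Data.List.Relation.Unary.All using (All)
open import Data.List.Relation.Unary.AllPairs using (AllPairs)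
open import Data.List.Relation.Unary.Unique.Propositional using (Unique)
open import Data.List.Membership.Propositional using (_∈_)
open import Relation.Nullary using (¬_; Dec; yes; no)
open import Relation.Nullary.Decidable using (_×-dec_; _⊎-dec_; ¬?)
import Relation.Nullary.Decidable as Dec
open import Relation.Binary.PropositionalEquality using (_≡_; subst; sym)

-- Time intervals [s , f) as pairs (s , f); an edge exists at integer
-- timestep t if s ≤ t < f for one of its intervals.

Interval : Set
Interval = ℕ × ℕ

data WFIntervals (T : ℕ) : List Interval → Set where
  single : ∀ {s f} → s < f → f ≤ T → WFIntervals T ((s , f) ∷ [])
  cons   : ∀ {s f s' f' rest} → s < f → f < s' →
           WFIntervals T ((s' , f') ∷ rest) →
           WFIntervals T ((s , f) ∷ (s' , f') ∷ rest)

ExistsAt : List Interval → ℕ → Set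
ExistsAt L t = Any (λ i → proj₁ i ≤ t × t < proj₂ i) L

existsAt? : ∀ L t → Dec (ExistsAt L t)
existsAt? L t = any? (λ i → (proj₁ i ≤? t) ×-dec (t <? proj₂ i)) L

record TemporalGraph : Set where
  field
    n m T      : ℕ
    src dst    : Fin m → Fin n
    intervals  : Fin m → List Interval
    noLoop     : ∀ e → ¬ (src e ≡ dst e)
    simple     : ∀ e e' → ¬ (e ≡ e') →
                 ¬ ((src e ≡ src e' × dst e ≡ dst e') ⊎ (src e ≡ dst e' × dst e ≡ src e'))
    wf         : ∀ e → WFIntervals T (intervals e)

module _ (G : TemporalGraph) where
  open TemporalGraph G

  ShareEndpoint : Fin m → Fin m → Set
  ShareEndpoint e e' = (src e ≡ src e' ⊎ src e ≡ dst e') ⊎ (dst e ≡ src e' ⊎ dst e ≡ dst e')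

  CommonTime : Fin m → Fin m → Set
  CommonTime e e' = ∃[ t ] (ExistsAt (intervals e) t × ExistsAt (intervals e') t)

  Overlap : Fin m → Fin m → Set
  Overlap e e' = ¬ (e ≡ e') × ShareEndpoint e e' × CommonTime e e'

  private
    bound : List Interval → ℕ
    bound = foldr (λ i acc → proj₂ i + acc) 0

    bound-ok : ∀ L t → ExistsAt L t → t < bound L
    bound-ok ((s , f) ∷ L) t (here (_ , t<f)) = <-≤-trans t<f (m≤m+n f (bound L))
    bound-ok ((s , f) ∷ L) t (there p) = <-≤-trans (bound-ok L t p) (m≤n+m (bound L) f)

  commonTime? : ∀ e e' → Dec (CommonTime e e')
  commonTime? e e' = Dec.map′ to from
    (anyFin? {n = bound (intervals e)}
      (λ i → existsAt? (intervals e) (toℕ i) ×-dec existsAt? (intervals e') (toℕ i)))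
    where
      to : ∃ (λ i → ExistsAt (intervals e) (toℕ i) × ExistsAt (intervals e') (toℕ i)) → CommonTime e e'
      to (i , p) = toℕ i , p
      from : CommonTime e e' → ∃ (λ i → ExistsAt (intervals e) (toℕ i) × ExistsAt (intervals e') (toℕ i))
      from (t , p , q) = fromℕ< lt ,
        subst (λ x → ExistsAt (intervals e) x × ExistsAt (intervals e') x) (sym (toℕ-fromℕ< lt)) (p , q)
        where lt = bound-ok (intervals e) t p

  overlap? : ∀ e e' → Dec (Overlap e e')
  overlap? e e' = ¬? (e ≟ᶠ e') ×-dec
    ((((src e ≟ᶠ src e') ⊎-dec (src e ≟ᶠ dst e')) ⊎-dec ((dst e ≟ᶠ src e') ⊎-dec (dst e ≟ᶠ dst e')))
      ×-dec commonTime? e e')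

  degIn : List (Fin m) → Fin m → ℕ
  degIn E' e = length (filter (overlap? e) E')

  𝒩 : Fin m → ℕ
  𝒩 e = degIn (allFin m) e

  total𝒩 : ℕ
  total𝒩 = sum (map 𝒩 (allFin m))

  IsMatching : List (Fin m) → Set
  IsMatching M = Unique M × AllPairs (λ e e' → ¬ Overlap e e') M

  IsMaximumMatching : List (Fin m) → Set
  IsMaximumMatching M = IsMatching M × (∀ M' → IsMatching M' → length M' ≤ length M)

  removeWith : Fin m → List (Fin m) → List (Fin m)
  removeWith e = filter (λ j → ¬? (j ≟ᶠ e) ×-dec ¬? (overlap? e j))

  -- Greedy E' M : some run of the greedy algorithm (arbitrary tie-breaking)
  -- starting from the remaining edge list E' outputs M.
  data Greedy : List (Fin m) → List (Fin m) → Set where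
    done : Greedy [] []
    step : ∀ {E' M} e → e ∈ E' →
           (∀ e' → e' ∈ E' → degIn E' e ≤ degIn E' e') →
           Greedy (removeWith e E') M →
           Greedy E' (e ∷ M)

-- Greedy is a Caro–Wei type argument on the conflict graph of the edges.
-- Weight a set E of remaining edges by w(E) = Σ_{e ∈ E} (1 + deg_E e).  If the
-- chosen edge has degree d, the k ≤ d + 1 edges it removes all have degree ≥ d,
-- and the remaining degrees can only drop, so w loses at least k(d + 1) ≥ k².
-- Induction along the run with the Cauchy–Schwarz step
-- n² ≤ r x ⇒ (n + k)² ≤ (r + 1)(x + k²) gives |E|² ≤ |M| w(E); for E = ℰ this
-- is m² ≤ |M| (Σ 𝒩 + m), and |M^opt| ≤ m since a matching has no repeated edge.
module Submission where

open import Defs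
open import Data.Nat
open import Data.Nat.Properties
open import Data.Nat.ListAction using (sum)
open import Data.Nat.Tactic.RingSolver using (solve-∀)
open import Data.List using (List; []; _∷_; length; filter; map; allFin)
open import Data.List.Properties using (filter-notAll; length-tabulate)
open import Data.List.Relation.Unary.Any using (here; there)
import Data.List.Relation.Unary.Any as Any
import Data.List.Relation.Unary.All as All
open import Data.List.Relation.Unary.AllPairs using (_∷_)
open import Data.List.Relation.Unary.Unique.Propositional using (Unique)
open import Data.List.Relation.Unary.Unique.Propositional.Properties using (filter⁺; allFin⁺)
open import Data.List.Relation.Binary.Sublist.Propositional.Properties
  using (length-mono-≤; filter-⊆) renaming (filter⁺ to Sublist-filter⁺)
open import Data.List.Membership.Propositional using (_∈_)
open import Data.List.Membership.Propositional.Properties using (∈-filter⁺; ∈-filter⁻; ∈-allFin)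
open import Data.Fin using (Fin)
open import Data.Fin.Properties using () renaming (_≟_ to _≟ᶠ_)
open import Data.Sum using (inj₁; inj₂)
open import Data.Product using (_×_; _,_; proj₁)
open import Relation.Nullary using (¬_; yes; no; contradiction)
open import Relation.Nullary.Decidable using (¬?; _×-dec_)
open import Relation.Unary using (Pred; Decidable)
open import Relation.Unary.Properties using (∁?)
open import Relation.Binary.Definitions using (DecidableEquality)
open import Relation.Binary.PropositionalEquality
open import Function using (_∘_; id)

2mn≤m²+n²-of-≤ : ∀ {m n} → m ≤ n → 2 * m * n ≤ m * m + n * n
2mn≤m²+n²-of-≤ {m} {n} m≤n =
  subst (λ n → 2 * m * n ≤ m * m + n * n) (m+[n∸m]≡n m≤n)
    (subst (2 * m * (m + c) ≤_) (expand m c) (m≤m+n _ (c * c)))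
  where
  c = n ∸ m
  expand : ∀ a c → 2 * a * (a + c) + c * c ≡ a * a + (a + c) * (a + c)
  expand = solve-∀

2mn≤m²+n² : ∀ m n → 2 * m * n ≤ m * m + n * n
2mn≤m²+n² m n with ≤-total m n
... | inj₁ m≤n = 2mn≤m²+n²-of-≤ m≤n
... | inj₂ n≤m = subst₂ _≤_ (swap n m) (+-comm (n * n) (m * m)) (2mn≤m²+n²-of-≤ n≤m)
  where
  swap : ∀ a b → 2 * a * b ≡ 2 * b * a
  swap = solve-∀

n²≤rx⇒[n+k]²≤[1+r][x+k²] : ∀ {n r x} k → n * n ≤ r * x → (n + k) * (n + k) ≤ suc r * (x + k * k)
n²≤rx⇒[n+k]²≤[1+r][x+k²] {zero} {zero} {x} k _ = ≤-trans (m≤n+m (k * k) x) (m≤m+n _ 0)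
n²≤rx⇒[n+k]²≤[1+r][x+k²] {suc _} {zero} k ()
n²≤rx⇒[n+k]²≤[1+r][x+k²] {n} {r@(suc _)} {x} k n²≤rx = begin
    (n + k) * (n + k)                 ≡⟨ expand n k ⟩
    n * n + 2 * k * n + k * k         ≤⟨ +-monoˡ-≤ (k * k) (+-mono-≤ n²≤rx 2kn≤x+rk²) ⟩
    r * x + (x + r * (k * k)) + k * k ≡⟨ collect r x (k * k) ⟩
    suc r * (x + k * k)               ∎
  where
  open ≤-Reasoning
  expand : ∀ n k → (n + k) * (n + k) ≡ n * n + 2 * k * n + k * k
  expand = solve-∀
  collect : ∀ r x y → r * x + (x + r * y) + y ≡ suc r * (x + y)
  collect = solve-∀
  2kn≤x+rk² : 2 * k * n ≤ x + r * (k * k)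
  2kn≤x+rk² = *-cancelˡ-≤ r (begin
      r * (2 * k * n)             ≡⟨ regroup r k n ⟩
      2 * n * (r * k)             ≤⟨ 2mn≤m²+n² n (r * k) ⟩
      n * n + r * k * (r * k)     ≤⟨ +-monoˡ-≤ _ n²≤rx ⟩
      r * x + r * k * (r * k)     ≡⟨ factor r x k ⟩
      r * (x + r * (k * k))       ∎)
    where
    regroup : ∀ r k n → r * (2 * k * n) ≡ 2 * n * (r * k)
    regroup = solve-∀
    factor : ∀ r x k → r * x + r * k * (r * k) ≡ r * (x + r * (k * k))
    factor = solve-∀

module _ {a p} {A : Set a} {P : Pred A p} (P? : Decidable P) where

  length-filter+length-filter-∁ : ∀ xs → length (filter P? xs) + length (filter (∁? P?) xs) ≡ length xs
  length-filter+length-filter-∁ [] = refl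
  length-filter+length-filter-∁ (x ∷ xs) with P? x
  ... | yes _ = cong suc (length-filter+length-filter-∁ xs)
  ... | no _ = trans (+-suc _ _) (cong suc (length-filter+length-filter-∁ xs))

  sum-map-filter+sum-map-filter-∁ : ∀ (f : A → ℕ) xs →
    sum (map f (filter P? xs)) + sum (map f (filter (∁? P?) xs)) ≡ sum (map f xs)
  sum-map-filter+sum-map-filter-∁ f [] = refl
  sum-map-filter+sum-map-filter-∁ f (x ∷ xs) with P? x
  ... | yes _ = trans (+-assoc (f x) _ _) (cong (f x +_) (sum-map-filter+sum-map-filter-∁ f xs))
  ... | no _ = trans (x+[y+z]≡y+[x+z] (sum (map f (filter P? xs))) (f x) _) (cong (f x +_) (sum-map-filter+sum-map-filter-∁ f xs))
    where
    x+[y+z]≡y+[x+z] : ∀ a b c → a + (b + c) ≡ b + (a + c)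
    x+[y+z]≡y+[x+z] = solve-∀

module _ {a} {A : Set a} where

  sum-map-mono-≤ : ∀ {f g : A → ℕ} → (∀ x → f x ≤ g x) → ∀ xs → sum (map f xs) ≤ sum (map g xs)
  sum-map-mono-≤ f≤g [] = z≤n
  sum-map-mono-≤ f≤g (x ∷ xs) = +-mono-≤ (f≤g x) (sum-map-mono-≤ f≤g xs)

  length*≤sum-map : ∀ {d} (f : A → ℕ) xs → (∀ {x} → x ∈ xs → d ≤ f x) → length xs * d ≤ sum (map f xs)
  length*≤sum-map f [] _ = z≤n
  length*≤sum-map f (x ∷ xs) d≤f = +-mono-≤ (d≤f (here refl)) (length*≤sum-map f xs (d≤f ∘ there))

  sum-map-suc : ∀ (f : A → ℕ) xs → sum (map (suc ∘ f) xs) ≡ sum (map f xs) + length xs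
  sum-map-suc f [] = refl
  sum-map-suc f (x ∷ xs) = trans (cong (suc ∘ (f x +_)) (sum-map-suc f xs)) (reassoc (f x) _ _)
    where
    reassoc : ∀ a b c → suc (a + (b + c)) ≡ a + b + suc c
    reassoc = solve-∀

  module _ (_≟_ : DecidableEquality A) where

    Unique-⊆⇒length≤ : ∀ {xs ys : List A} → Unique xs → (∀ {x} → x ∈ xs → x ∈ ys) → length xs ≤ length ys
    Unique-⊆⇒length≤ {[]} _ _ = z≤n
    Unique-⊆⇒length≤ {x ∷ xs} {ys} (x∉xs ∷ xs!) xs⊆ys =
      <-≤-trans (s≤s (Unique-⊆⇒length≤ xs! xs⊆ys-x))
        (filter-notAll (λ y → ¬? (y ≟ x)) ys (Any.map (λ { refl x≢x → x≢x refl }) (xs⊆ys (here refl))))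
      where
      xs⊆ys-x : ∀ {z} → z ∈ xs → z ∈ filter (λ y → ¬? (y ≟ x)) ys
      xs⊆ys-x z∈xs = ∈-filter⁺ (λ y → ¬? (y ≟ x)) (xs⊆ys (there z∈xs)) λ { refl → All.lookup x∉xs z∈xs refl }

module _ (G : TemporalGraph) where
  open TemporalGraph G

  weight : List (Fin m) → ℕ
  weight E = sum (map (suc ∘ degIn G E) E)

  kept? : (e : Fin m) → Decidable (λ j → ¬ j ≡ e × ¬ Overlap G e j)
  kept? e j = ¬? (j ≟ᶠ e) ×-dec ¬? (overlap? G e j)

  removed : Fin m → List (Fin m) → List (Fin m)
  removed e = filter (∁? (kept? e))

  degIn-removeWith-≤ : ∀ e E v → degIn G (removeWith G e E) v ≤ degIn G E v
  degIn-removeWith-≤ e E v =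
    length-mono-≤ (Sublist-filter⁺ (overlap? G v) (overlap? G v) (λ { refl o → o }) (filter-⊆ (kept? e) E))

  removed⊆self∷overlapping : ∀ e E {x} → x ∈ removed e E → x ∈ e ∷ filter (overlap? G e) E
  removed⊆self∷overlapping e E {x} x∈removed with ∈-filter⁻ (∁? (kept? e)) {xs = E} x∈removed
  ... | x∈E , x-not-kept with x ≟ᶠ e | overlap? G e x
  ... | yes refl | _ = here refl
  ... | no _ | yes e-x = there (∈-filter⁺ (overlap? G e) x∈E e-x)
  ... | no x≢e | no ¬e-x = contradiction (x≢e , ¬e-x) x-not-kept

  length-removed-≤ : ∀ {E} e → Unique E → length (removed e E) ≤ suc (degIn G E e)
  length-removed-≤ {E} e E! =
    Unique-⊆⇒length≤ _≟ᶠ_ (filter⁺ (∁? (kept? e)) E!) (removed⊆self∷overlapping e E)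

  weight-removeWith : ∀ {E} e → Unique E → (∀ e' → e' ∈ E → degIn G E e ≤ degIn G E e') →
    let k = length (removed e E) in weight (removeWith G e E) + k * k ≤ weight E
  weight-removeWith {E} e E! e-minimal = begin
    weight R + k * k                          ≤⟨ +-monoʳ-≤ (weight R) (*-monoʳ-≤ k (length-removed-≤ e E!)) ⟩
    weight R + k * suc d                      ≤⟨ +-mono-≤ weight-R≤ weight-S≥ ⟩
    sum (map w R) + sum (map w S)             ≡⟨ sum-map-filter+sum-map-filter-∁ (kept? e) w E ⟩
    weight E                                  ∎
    where
    open ≤-Reasoning
    R = removeWith G e E
    S = removed e E
    k = length S
    d = degIn G E e
    w = suc ∘ degIn G E
    weight-R≤ : weight R ≤ sum (map w R)
    weight-R≤ = sum-map-mono-≤ (λ v → s≤s (degIn-removeWith-≤ e E v)) R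
    weight-S≥ : k * suc d ≤ sum (map w S)
    weight-S≥ = length*≤sum-map w S (λ x∈S → s≤s (e-minimal _ (proj₁ (∈-filter⁻ (∁? (kept? e)) {xs = E} x∈S))))

  greedy-invariant : ∀ {E M} → Unique E → Greedy G E M → length E * length E ≤ length M * weight E
  greedy-invariant _ done = z≤n
  greedy-invariant {E} {e ∷ M} E! (step e _ e-minimal run) =
    subst (λ l → l * l ≤ suc (length M) * weight E) (length-filter+length-filter-∁ (kept? e) E) (begin
      (length R + k) * (length R + k)     ≤⟨ n²≤rx⇒[n+k]²≤[1+r][x+k²] {length R} {length M} {weight R} k invariant-R ⟩
      suc (length M) * (weight R + k * k) ≤⟨ *-monoʳ-≤ (suc (length M)) (weight-removeWith e E! e-minimal) ⟩
      suc (length M) * weight E           ∎)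
    where
    open ≤-Reasoning
    R = removeWith G e E
    k = length (removed e E)
    invariant-R : length R * length R ≤ length M * weight R
    invariant-R = greedy-invariant (filter⁺ (kept? e) E!) run

  weight-allFin : weight (allFin m) ≡ total𝒩 G + m
  weight-allFin = trans (sum-map-suc (𝒩 G) (allFin m)) (cong (total𝒩 G +_) (length-tabulate id))

theorem7 : (G : TemporalGraph) → 1 ≤ TemporalGraph.m G →
    (M : List (Fin (TemporalGraph.m G))) → Greedy G (allFin (TemporalGraph.m G)) M →
    (Mopt : List (Fin (TemporalGraph.m G))) → IsMaximumMatching G Mopt →
    TemporalGraph.m G * length Mopt ≤ length M * (total𝒩 G + TemporalGraph.m G)
theorem7 G _ M run Mopt ((Mopt! , _) , _) = begin
  m * length Mopt                         ≤⟨ *-monoʳ-≤ m length-Mopt≤m ⟩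
  m * m                                   ≡⟨ cong (λ l → l * l) (sym length-allFin) ⟩
  length (allFin m) * length (allFin m)   ≤⟨ greedy-invariant G (allFin⁺ m) run ⟩
  length M * weight G (allFin m)          ≡⟨ cong (length M *_) (weight-allFin G) ⟩
  length M * (total𝒩 G + m)               ∎
  where
  open TemporalGraph G
  open ≤-Reasoning
  length-allFin : length (allFin m) ≡ m
  length-allFin = length-tabulate id
  length-Mopt≤m : length Mopt ≤ m
  length-Mopt≤m = subst (length Mopt ≤_) length-allFin (Unique-⊆⇒length≤ _≟ᶠ_ Mopt! (λ {x} _ → ∈-allFin x))
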